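{- Let $H=([n],E_H)$ be a connected unweighted graph with $m=|E_H|$. Let $G_1$ be the Sparsest Cut instance with vertex set $V_1=\{s,t\}\cup[n]$, supply edges $\{s,i\},\{t,i\}$ for all $i\in[n]$ with capacities $\mathrm{cap}_{s,i}=\mathrm{cap}_{t,i}=\deg_H(i)/2m$, and demands $\mathrm{dem}_{i,j}=1/m$ for each $\{i,j\}\in E_H$ (and no other demands; in particular no demand between $s$ and $t$). Then: (1) if $H$ has a cut of size $cm$, then $G_1$ has a cut separating $s$ and $t$ of capacity $1$ that separates $c$ units of demand; (2) every cut separating $s$ and $t$ has capacity at least $1$; (3) if the maximum cut in $H$ has size $sm$, then every cut separating $s$ and $t$ has sparsity at least $s^{ -1}$; (4) every cut that does not separate $s$ and $t$ has sparsity at least $1$.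
   Context: The capacity of a cut $(A,V_1\setminus A)$ is the total capacity of supply edges with exactly one endpoint in $A$; the demand it separates is the total demand of pairs with exactly one endpoint in $A$; its sparsity is the ratio capacity/demand (taken to be $+\infty$ if no demand is separated). -}

module Defs where

open import Data.Nat as ℕ using (ℕ; zero; suc)
open import Data.Fin using (Fin; zero; suc; _<?_)
open import Data.Bool using (Bool; true; false; _xor_; if_then_else_)
open import Data.Integer using (+_)
open import Data.Rational using (ℚ; 0ℚ; _+_; _*_; _÷_; _/_; ½; _≤_; _≟_; ≢-nonZero)
open import Relation.Nullary using (yes; no)
open import Relation.Binary.PropositionalEquality using (_≡_)
open import Data.Empty using (⊥)
open import Data.Unit using (⊤)

Σℚ : (n : ℕ) → (Fin n → ℚ) → ℚ
Σℚ zero    f = 0ℚ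
Σℚ (suc n) f = f zero + Σℚ n (λ i → f (suc i))

Σℕ : (n : ℕ) → (Fin n → ℕ) → ℕ
Σℕ zero    f = 0
Σℕ (suc n) f = f zero ℕ.+ Σℕ n (λ i → f (suc i))

-- sum over unordered pairs {x,y}, enumerated as x < y
ΣpairsQ : (n : ℕ) → (Fin n → Fin n → ℚ) → ℚ
ΣpairsQ n f = Σℚ n (λ x → Σℚ n (λ y → if ⌊ x <? y ⌋ then f x y else 0ℚ))
  where open import Relation.Nullary.Decidable using (⌊_⌋)

ΣpairsN : (n : ℕ) → (Fin n → Fin n → ℕ) → ℕ
ΣpairsN n f = Σℕ n (λ x → Σℕ n (λ y → if ⌊ x <? y ⌋ then f x y else 0))
  where open import Relation.Nullary.Decidable using (⌊_⌋)

ind : Bool → ℕ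
ind true  = 1
ind false = 0

indℚ : Bool → ℚ
indℚ true  = + 1 / 1
indℚ false = 0ℚ

record Graph (n : ℕ) : Set where
  field
    adj   : Fin n → Fin n → Bool
    sym   : ∀ i j → adj i j ≡ adj j i
    irrefl : ∀ i → adj i i ≡ false
open Graph public

data Reachable {n : ℕ} (H : Graph n) : Fin n → Fin n → Set where
  here : ∀ {i} → Reachable H i i
  step : ∀ {i j k} → adj H i j ≡ true → Reachable H j k → Reachable H i k

Connected : {n : ℕ} → Graph n → Set
Connected {n} H = ∀ (i j : Fin n) → Reachable H i j

numEdges : {n : ℕ} → Graph n → ℕ
numEdges {n} H = ΣpairsN n (λ i j → ind (adj H i j))

deg : {n : ℕ} → Graph n → Fin n → ℕ
deg {n} H i = Σℕ n (λ j → ind (adj H i j))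

cutSizeH : {n : ℕ} → Graph n → (Fin n → Bool) → ℕ
cutSizeH {n} H S = ΣpairsN n (λ i j → ind (adj H i j) ℕ.* ind (S i xor S j))

-- Sparsest Cut instances on vertex set Fin N: symmetric capacity (supply)
-- and demand functions; only unordered pairs {x,y} (x < y) are used.

record SCInstance (N : ℕ) : Set where
  field
    cap : Fin N → Fin N → ℚ
    dem : Fin N → Fin N → ℚ
open SCInstance public

capacity : {N : ℕ} → SCInstance N → (Fin N → Bool) → ℚ
capacity {N} G A = ΣpairsQ N (λ x y → cap G x y * indℚ (A x xor A y))

demand : {N : ℕ} → SCInstance N → (Fin N → Bool) → ℚ
demand {N} G A = ΣpairsQ N (λ x y → dem G x y * indℚ (A x xor A y))

data ℚ∞ : Set where
  fin : ℚ → ℚ∞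
  ∞   : ℚ∞

_≤∞_ : ℚ∞ → ℚ∞ → Set
fin p ≤∞ fin q = p ≤ q
fin p ≤∞ ∞     = ⊤
∞     ≤∞ fin q = ⊥
∞     ≤∞ ∞     = ⊤

sparsity : {N : ℕ} → SCInstance N → (Fin N → Bool) → ℚ∞
sparsity G A with demand G A ≟ 0ℚ
... | yes _  = ∞
... | no d≢0 = fin (_÷_ (capacity G A) (demand G A) {{≢-nonZero d≢0}})

-- The instance G₁: V₁ = {s, t} ∪ [n] encoded as Fin (2 + n) with
-- s = 0, t = 1 and vertex i ∈ [n] as 2 + i.

sV : {n : ℕ} → Fin (2 ℕ.+ n)
sV = zero

tV : {n : ℕ} → Fin (2 ℕ.+ n)
tV = suc zero

vV : {n : ℕ} → Fin n → Fin (2 ℕ.+ n)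
vV i = suc (suc i)

module _ {n : ℕ} (H : Graph n) .{{m≢0 : ℕ.NonZero (numEdges H)}} where

  capST : Fin n → ℚ
  capST i = ((+ deg H i) / numEdges H) * ½

  G₁cap : Fin (2 ℕ.+ n) → Fin (2 ℕ.+ n) → ℚ
  G₁cap zero          (suc (suc i)) = capST i
  G₁cap (suc zero)    (suc (suc i)) = capST i
  G₁cap (suc (suc i)) zero          = capST i
  G₁cap (suc (suc i)) (suc zero)    = capST i
  G₁cap _             _             = 0ℚ

  G₁dem : Fin (2 ℕ.+ n) → Fin (2 ℕ.+ n) → ℚ
  G₁dem (suc (suc i)) (suc (suc j)) = if adj H i j then (+ 1 / numEdges H) else 0ℚ
  G₁dem _             _             = 0ℚ

  G₁ : SCInstance (2 ℕ.+ n)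
  G₁ = record { cap = G₁cap ; dem = G₁dem }

Separates : {N : ℕ} → (Fin N → Bool) → Fin N → Fin N → Set
Separates A x y = (A x xor A y) ≡ true

-- Every vertex i of H is joined to both s and t by an edge of capacity deg(i)/2m, so the capacity of a
-- cut A is (1/2m)·(D(A s) + D(A t)), where D(a) is the total degree of the vertices of [n] lying off side a,
-- while its demand is (1/m)·(the number of edges of H cut by A). If A separates s and t, every vertex of
-- [n] is off exactly one of the two sides, so the capacity is (1/2m)·Σ deg = 1 by the handshake lemma.
-- Otherwise the capacity is D(A s)/m, and every edge cut by A has an endpoint off the side of s, so the
-- capacity dominates the demand.
module Submission where

open import Defs
open import Data.Nat as ℕ using (ℕ; zero; suc)
import Data.Nat.Properties as ℕ
open import Data.Fin using (Fin; zero; suc; _<?_)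
open import Data.Bool using (Bool; true; false; _xor_; if_then_else_)
open import Data.Integer as ℤ using (+_)
import Data.Integer.Properties as ℤ
open import Data.Integer.Solver using (module +-*-Solver)
open import Data.Rational
  using (ℚ; 0ℚ; 1ℚ; _+_; _*_; _/_; ½; _≤_; _≟_; ≢-nonZero; 1/_; NonZero; NonNegative; nonNegative; toℚᵘ)
open import Data.Rational.Properties
  using ( toℚᵘ-injective; toℚᵘ-fromℚᵘ; toℚᵘ-cancel-≤; toℚᵘ-homo-+; toℚᵘ-homo-*
        ; +-identityˡ; +-identityʳ; *-zeroˡ; *-zeroʳ; *-identityˡ; *-identityʳ; *-assoc; *-distribʳ-+
        ; *-inverseˡ; ≤-trans; ≤-reflexive; *-monoʳ-≤-nonNeg; *-monoˡ-≤-nonNeg; *-cancelʳ-≤-pos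
        ; normalize-nonNeg; nonNeg∧nonZero⇒pos; pos⇒nonZero; pos⇒nonNeg; 1/pos⇒pos; module ≤-Reasoning)
import Data.Rational.Unnormalised as ℚᵘ
import Data.Rational.Unnormalised.Properties as ℚᵘ
import Data.Rational.Solver as ℚ-Solver
open import Data.Product using (Σ; _×_; _,_)
open import Data.Unit using (tt)
open import Data.Empty using (⊥-elim)
open import Function using (_∘_)
open import Relation.Nullary using (¬_; yes; no)
open import Relation.Nullary.Decidable using (⌊_⌋)
open import Relation.Binary.PropositionalEquality
  using (_≡_; _≢_; refl; trans; cong; cong₂; module ≡-Reasoning)
  renaming (sym to ≡-sym)

⌊suc<?suc⌋ : ∀ {n} (x y : Fin n) → ⌊ suc x <? suc y ⌋ ≡ ⌊ x <? y ⌋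
⌊suc<?suc⌋ x y with x <? y | suc x <? suc y
... | yes _   | yes _   = refl
... | no _    | no _    = refl
... | yes x<y | no sx≮sy = ⊥-elim (sx≮sy (ℕ.s≤s x<y))
... | no x≮y  | yes sx<sy = ⊥-elim (x≮y (ℕ.≤-pred sx<sy))

Σℕ-cong : ∀ n {f g : Fin n → ℕ} → (∀ i → f i ≡ g i) → Σℕ n f ≡ Σℕ n g
Σℕ-cong zero    f≡g = refl
Σℕ-cong (suc n) f≡g = cong₂ ℕ._+_ (f≡g zero) (Σℕ-cong n (f≡g ∘ suc))

Σℕ-mono-≤ : ∀ n {f g : Fin n → ℕ} → (∀ i → f i ℕ.≤ g i) → Σℕ n f ℕ.≤ Σℕ n g
Σℕ-mono-≤ zero    f≤g = ℕ.z≤n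
Σℕ-mono-≤ (suc n) f≤g = ℕ.+-mono-≤ (f≤g zero) (Σℕ-mono-≤ n (f≤g ∘ suc))

Σℕ-distrib-+ : ∀ n (f g : Fin n → ℕ) → Σℕ n (λ i → f i ℕ.+ g i) ≡ Σℕ n f ℕ.+ Σℕ n g
Σℕ-distrib-+ zero    f g = refl
Σℕ-distrib-+ (suc n) f g =
  trans (cong (f zero ℕ.+ g zero ℕ.+_) (Σℕ-distrib-+ n (f ∘ suc) (g ∘ suc)))
        (interchange (f zero) (g zero) (Σℕ n (f ∘ suc)) (Σℕ n (g ∘ suc)))
  where open import Algebra.Properties.CommutativeSemigroup ℕ.+-commutativeSemigroup using (interchange)

Σℕ-*ˡ : ∀ n c (f : Fin n → ℕ) → Σℕ n (λ i → c ℕ.* f i) ≡ c ℕ.* Σℕ n f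
Σℕ-*ˡ zero    c f = ≡-sym (ℕ.*-zeroʳ c)
Σℕ-*ˡ (suc n) c f =
  trans (cong (c ℕ.* f zero ℕ.+_) (Σℕ-*ˡ n c (f ∘ suc))) (≡-sym (ℕ.*-distribˡ-+ c (f zero) _))

Σℕ-*ʳ : ∀ n c (f : Fin n → ℕ) → Σℕ n (λ i → f i ℕ.* c) ≡ Σℕ n f ℕ.* c
Σℕ-*ʳ n c f = trans (Σℕ-cong n (λ i → ℕ.*-comm (f i) c)) (trans (Σℕ-*ˡ n c f) (ℕ.*-comm c _))

ΣpairsN-cong : ∀ n {f g : Fin n → Fin n → ℕ} → (∀ i j → f i j ≡ g i j) → ΣpairsN n f ≡ ΣpairsN n g
ΣpairsN-cong n f≡g = Σℕ-cong n (λ x → Σℕ-cong n (λ y → cong (λ k → if ⌊ x <? y ⌋ then k else 0) (f≡g x y)))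

ΣpairsN-mono-≤ : ∀ n {f g : Fin n → Fin n → ℕ} → (∀ i j → f i j ℕ.≤ g i j) → ΣpairsN n f ℕ.≤ ΣpairsN n g
ΣpairsN-mono-≤ n f≤g = Σℕ-mono-≤ n (λ x → Σℕ-mono-≤ n (λ y → if-mono ⌊ x <? y ⌋ (f≤g x y)))
  where
  if-mono : ∀ b {k l} → k ℕ.≤ l → (if b then k else 0) ℕ.≤ (if b then l else 0)
  if-mono true  k≤l = k≤l
  if-mono false k≤l = ℕ.z≤n

ΣpairsN-*ˡ : ∀ n c (f : Fin n → Fin n → ℕ) → ΣpairsN n (λ i j → c ℕ.* f i j) ≡ c ℕ.* ΣpairsN n f
ΣpairsN-*ˡ n c f =
  trans (Σℕ-cong n (λ x → trans (Σℕ-cong n (λ y → if-*ˡ ⌊ x <? y ⌋)) (Σℕ-*ˡ n c _))) (Σℕ-*ˡ n c _)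
  where
  if-*ˡ : ∀ {x y} b → (if b then c ℕ.* f x y else 0) ≡ c ℕ.* (if b then f x y else 0)
  if-*ˡ true  = refl
  if-*ˡ false = ≡-sym (ℕ.*-zeroʳ c)

ΣpairsN-suc : ∀ n f →
  ΣpairsN (suc n) f ≡ Σℕ n (λ y → f zero (suc y)) ℕ.+ ΣpairsN n (λ x y → f (suc x) (suc y))
ΣpairsN-suc n f = cong (Σℕ n (λ y → f zero (suc y)) ℕ.+_)
  (Σℕ-cong n (λ x → Σℕ-cong n (λ y →
    cong (λ b → if b then f (suc x) (suc y) else 0) (⌊suc<?suc⌋ x y))))

Σ²ℕ≡ΣpairsN : ∀ n (g : Fin n → Fin n → ℕ) → (∀ i → g i i ≡ 0) →
  Σℕ n (λ x → Σℕ n (g x)) ≡ ΣpairsN n (λ x y → g x y ℕ.+ g y x)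
Σ²ℕ≡ΣpairsN zero    g g-diag = refl
Σ²ℕ≡ΣpairsN (suc n) g g-diag = begin
    (g zero zero ℕ.+ row) ℕ.+ Σℕ n (λ x → g (suc x) zero ℕ.+ Σℕ n (g (suc x) ∘ suc))
  ≡⟨ cong₂ ℕ._+_ (cong (ℕ._+ row) (g-diag zero)) (Σℕ-distrib-+ n _ _) ⟩
    row ℕ.+ (column ℕ.+ Σℕ n (λ x → Σℕ n (g′ x)))
  ≡⟨ cong (λ k → row ℕ.+ (column ℕ.+ k)) (Σ²ℕ≡ΣpairsN n g′ (g-diag ∘ suc)) ⟩
    row ℕ.+ (column ℕ.+ rest)
  ≡⟨ ≡-sym (ℕ.+-assoc row column rest) ⟩
    (row ℕ.+ column) ℕ.+ rest
  ≡⟨ cong (ℕ._+ rest) (≡-sym (Σℕ-distrib-+ n _ _)) ⟩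
    Σℕ n (λ y → g zero (suc y) ℕ.+ g (suc y) zero) ℕ.+ rest
  ≡⟨ ≡-sym (ΣpairsN-suc n (λ x y → g x y ℕ.+ g y x)) ⟩
    ΣpairsN (suc n) (λ x y → g x y ℕ.+ g y x) ∎
  where
  open ≡-Reasoning
  row    = Σℕ n (λ y → g zero (suc y))
  column = Σℕ n (λ x → g (suc x) zero)
  g′     = λ x y → g (suc x) (suc y)
  rest   = ΣpairsN n (λ x y → g′ x y ℕ.+ g′ y x)

ind-xor-triangle : ∀ a u v → ind (u xor v) ℕ.≤ ind (a xor u) ℕ.+ ind (a xor v)
ind-xor-triangle false false false = ℕ.z≤n
ind-xor-triangle false false true  = ℕ.s≤s ℕ.z≤n
ind-xor-triangle false true  false = ℕ.s≤s ℕ.z≤n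
ind-xor-triangle false true  true  = ℕ.z≤n
ind-xor-triangle true  false false = ℕ.z≤n
ind-xor-triangle true  false true  = ℕ.s≤s ℕ.z≤n
ind-xor-triangle true  true  false = ℕ.s≤s ℕ.z≤n
ind-xor-triangle true  true  true  = ℕ.z≤n

ind-xor-complementary : ∀ a b c → (a xor b) ≡ true → ind (a xor c) ℕ.+ ind (b xor c) ≡ 1
ind-xor-complementary false true  false _ = refl
ind-xor-complementary false true  true  _ = refl
ind-xor-complementary true  false false _ = refl
ind-xor-complementary true  false true  _ = refl

xor≢true⇒≡ : ∀ a b → (a xor b) ≢ true → a ≡ b
xor≢true⇒≡ false false _ = refl
xor≢true⇒≡ true  true  _ = refl
xor≢true⇒≡ false true  ¬a⊕b = ⊥-elim (¬a⊕b refl)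
xor≢true⇒≡ true  false ¬a⊕b = ⊥-elim (¬a⊕b refl)

module _ {n : ℕ} (H : Graph n) where

  Σdeg≡2*numEdges : Σℕ n (deg H) ≡ 2 ℕ.* numEdges H
  Σdeg≡2*numEdges = begin
      Σℕ n (λ i → Σℕ n (λ j → ind (adj H i j)))
    ≡⟨ Σ²ℕ≡ΣpairsN n _ (λ i → cong ind (irrefl H i)) ⟩
      ΣpairsN n (λ i j → ind (adj H i j) ℕ.+ ind (adj H j i))
    ≡⟨ ΣpairsN-cong n (λ i j → cong (λ b → ind (adj H i j) ℕ.+ ind b) (≡-sym (Graph.sym H i j))) ⟩
      ΣpairsN n (λ i j → ind (adj H i j) ℕ.+ ind (adj H i j))
    ≡⟨ ΣpairsN-cong n (λ i j → cong (ind (adj H i j) ℕ.+_) (≡-sym (ℕ.+-identityʳ _))) ⟩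
      ΣpairsN n (λ i j → 2 ℕ.* ind (adj H i j))
    ≡⟨ ΣpairsN-*ˡ n 2 _ ⟩
      2 ℕ.* numEdges H ∎
    where open ≡-Reasoning

  degOutside : (Fin n → Bool) → Bool → ℕ
  degOutside S a = Σℕ n (λ i → deg H i ℕ.* ind (a xor S i))

  degOutside-complementary : ∀ S a b → (a xor b) ≡ true →
    degOutside S a ℕ.+ degOutside S b ≡ 2 ℕ.* numEdges H
  degOutside-complementary S a b a⊕b = begin
      degOutside S a ℕ.+ degOutside S b
    ≡⟨ ≡-sym (Σℕ-distrib-+ n _ _) ⟩
      Σℕ n (λ i → deg H i ℕ.* ind (a xor S i) ℕ.+ deg H i ℕ.* ind (b xor S i))
    ≡⟨ Σℕ-cong n (λ i → begin
         deg H i ℕ.* ind (a xor S i) ℕ.+ deg H i ℕ.* ind (b xor S i)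
       ≡⟨ ≡-sym (ℕ.*-distribˡ-+ (deg H i) _ _) ⟩
         deg H i ℕ.* (ind (a xor S i) ℕ.+ ind (b xor S i))
       ≡⟨ cong (deg H i ℕ.*_) (ind-xor-complementary a b (S i) a⊕b) ⟩
         deg H i ℕ.* 1
       ≡⟨ ℕ.*-identityʳ (deg H i) ⟩
         deg H i ∎) ⟩
      Σℕ n (deg H)
    ≡⟨ Σdeg≡2*numEdges ⟩
      2 ℕ.* numEdges H ∎
    where open ≡-Reasoning

  -- Charge each cut edge to its endpoints off side a; it has at least one.
  cutSizeH≤degOutside : ∀ S a → cutSizeH H S ℕ.≤ degOutside S a
  cutSizeH≤degOutside S a = ℕ.≤-trans (ΣpairsN-mono-≤ n charge) (ℕ.≤-reflexive (≡-sym degOutside≡))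
    where
    off : Fin n → Fin n → ℕ
    off i j = ind (adj H i j) ℕ.* ind (a xor S i)
    charge : ∀ i j → ind (adj H i j) ℕ.* ind (S i xor S j) ℕ.≤ off i j ℕ.+ off j i
    charge i j rewrite Graph.sym H j i
                     | ≡-sym (ℕ.*-distribˡ-+ (ind (adj H i j)) (ind (a xor S i)) (ind (a xor S j))) =
      ℕ.*-monoʳ-≤ (ind (adj H i j)) (ind-xor-triangle a (S i) (S j))
    degOutside≡ : degOutside S a ≡ ΣpairsN n (λ i j → off i j ℕ.+ off j i)
    degOutside≡ = trans (Σℕ-cong n (λ i → ≡-sym (Σℕ-*ʳ n (ind (a xor S i)) (λ j → ind (adj H i j)))))
                        (Σ²ℕ≡ΣpairsN n off (λ i → cong (λ b → ind b ℕ.* ind (a xor S i)) (irrefl H i)))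

ℕ→ℚ : ℕ → ℚ
ℕ→ℚ k = + k / 1

toℚᵘ-/suc : ∀ i n → toℚᵘ (i / suc n) ℚᵘ.≃ ℚᵘ.mkℚᵘ i n
toℚᵘ-/suc i n = toℚᵘ-fromℚᵘ (ℚᵘ.mkℚᵘ i n)

ℕ→ℚ-+ : ∀ a b → ℕ→ℚ (a ℕ.+ b) ≡ ℕ→ℚ a + ℕ→ℚ b
ℕ→ℚ-+ a b = toℚᵘ-injective (ℚᵘ.≃-trans (toℚᵘ-/suc (+ (a ℕ.+ b)) 0) (ℚᵘ.≃-trans (ℚᵘ.*≡* integral)
  (ℚᵘ.≃-sym (ℚᵘ.≃-trans (toℚᵘ-homo-+ (ℕ→ℚ a) (ℕ→ℚ b))
                        (ℚᵘ.+-cong (toℚᵘ-/suc (+ a) 0) (toℚᵘ-/suc (+ b) 0))))))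
  where
  open +-*-Solver
  integral : + (a ℕ.+ b) ℤ.* + 1 ≡ (+ a ℤ.* + 1 ℤ.+ + b ℤ.* + 1) ℤ.* + 1
  integral = trans (cong (ℤ._* + 1) (ℤ.pos-+ a b))
    (solve 2 (λ x y → (x :+ y) :* con (+ 1) := (x :* con (+ 1) :+ y :* con (+ 1)) :* con (+ 1)) refl (+ a) (+ b))

ℕ→ℚ-* : ∀ a b → ℕ→ℚ (a ℕ.* b) ≡ ℕ→ℚ a * ℕ→ℚ b
ℕ→ℚ-* a b = toℚᵘ-injective (ℚᵘ.≃-trans (toℚᵘ-/suc (+ (a ℕ.* b)) 0) (ℚᵘ.≃-trans (ℚᵘ.*≡* (cong (ℤ._* + 1) (ℤ.pos-* a b)))
  (ℚᵘ.≃-sym (ℚᵘ.≃-trans (toℚᵘ-homo-* (ℕ→ℚ a) (ℕ→ℚ b))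
                        (ℚᵘ.*-cong (toℚᵘ-/suc (+ a) 0) (toℚᵘ-/suc (+ b) 0))))))

ℕ→ℚ-mono-≤ : ∀ {a b} → a ℕ.≤ b → ℕ→ℚ a ≤ ℕ→ℚ b
ℕ→ℚ-mono-≤ {a} {b} a≤b = toℚᵘ-cancel-≤
  (ℚᵘ.≤-respˡ-≃ (ℚᵘ.≃-sym (toℚᵘ-/suc (+ a) 0)) (ℚᵘ.≤-respʳ-≃ (ℚᵘ.≃-sym (toℚᵘ-/suc (+ b) 0))
    (ℚᵘ.*≤* (ℤ.*-monoʳ-≤-nonNeg (+ 1) (ℤ.+≤+ a≤b)))))

+/≡ℕ→ℚ*1/ : ∀ k m .{{_ : ℕ.NonZero m}} → + k / m ≡ ℕ→ℚ k * (+ 1 / m)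
+/≡ℕ→ℚ*1/ k (suc m) = toℚᵘ-injective (ℚᵘ.≃-trans (toℚᵘ-/suc (+ k) m) (ℚᵘ.≃-trans (ℚᵘ.*≡* integral)
  (ℚᵘ.≃-sym (ℚᵘ.≃-trans (toℚᵘ-homo-* (ℕ→ℚ k) (+ 1 / suc m))
                        (ℚᵘ.*-cong (toℚᵘ-/suc (+ k) 0) (toℚᵘ-/suc (+ 1) m))))))
  where
  open +-*-Solver
  integral : + k ℤ.* + suc (m ℕ.+ 0) ≡ (+ k ℤ.* + 1) ℤ.* + suc m
  integral rewrite ℕ.+-identityʳ m = solve 2 (λ x y → x :* y := (x :* con (+ 1)) :* y) refl (+ k) (+ suc m)

ℕ→ℚ*1/≡1 : ∀ m .{{_ : ℕ.NonZero m}} → ℕ→ℚ m * (+ 1 / m) ≡ 1ℚ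
ℕ→ℚ*1/≡1 (suc m) = toℚᵘ-injective (ℚᵘ.≃-trans (toℚᵘ-homo-* (ℕ→ℚ (suc m)) (+ 1 / suc m))
  (ℚᵘ.≃-trans (ℚᵘ.*-cong (toℚᵘ-/suc (+ suc m) 0) (toℚᵘ-/suc (+ 1) m)) (ℚᵘ.*≡* integral)))
  where
  open +-*-Solver
  integral : (+ suc m ℤ.* + 1) ℤ.* + 1 ≡ + 1 ℤ.* + suc (m ℕ.+ 0)
  integral rewrite ℕ.+-identityʳ m = solve 1 (λ x → (x :* con (+ 1)) :* con (+ 1) := con (+ 1) :* x) refl (+ suc m)

indℚ≡ℕ→ℚ∘ind : ∀ b → indℚ b ≡ ℕ→ℚ (ind b)
indℚ≡ℕ→ℚ∘ind true  = refl
indℚ≡ℕ→ℚ∘ind false = refl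

Σℚ-cong : ∀ n {f g : Fin n → ℚ} → (∀ i → f i ≡ g i) → Σℚ n f ≡ Σℚ n g
Σℚ-cong zero    f≡g = refl
Σℚ-cong (suc n) f≡g = cong₂ _+_ (f≡g zero) (Σℚ-cong n (f≡g ∘ suc))

Σℚ-≡0 : ∀ n {f : Fin n → ℚ} → (∀ i → f i ≡ 0ℚ) → Σℚ n f ≡ 0ℚ
Σℚ-≡0 zero    f≡0 = refl
Σℚ-≡0 (suc n) f≡0 = cong₂ _+_ (f≡0 zero) (Σℚ-≡0 n (f≡0 ∘ suc))

Σℚ-ℕ→ℚ-*ʳ : ∀ n (f : Fin n → ℕ) r → Σℚ n (λ i → ℕ→ℚ (f i) * r) ≡ ℕ→ℚ (Σℕ n f) * r
Σℚ-ℕ→ℚ-*ʳ zero    f r = ≡-sym (*-zeroˡ r)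
Σℚ-ℕ→ℚ-*ʳ (suc n) f r = begin
    ℕ→ℚ (f zero) * r + Σℚ n (λ i → ℕ→ℚ (f (suc i)) * r)
  ≡⟨ cong (λ q → ℕ→ℚ (f zero) * r + q) (Σℚ-ℕ→ℚ-*ʳ n (f ∘ suc) r) ⟩
    ℕ→ℚ (f zero) * r + ℕ→ℚ (Σℕ n (f ∘ suc)) * r
  ≡⟨ ≡-sym (*-distribʳ-+ r (ℕ→ℚ (f zero)) _) ⟩
    (ℕ→ℚ (f zero) + ℕ→ℚ (Σℕ n (f ∘ suc))) * r
  ≡⟨ cong (_* r) (≡-sym (ℕ→ℚ-+ (f zero) (Σℕ n (f ∘ suc)))) ⟩
    ℕ→ℚ (Σℕ (suc n) f) * r ∎
  where open ≡-Reasoning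

ΣpairsQ-cong : ∀ n {f g : Fin n → Fin n → ℚ} → (∀ i j → f i j ≡ g i j) → ΣpairsQ n f ≡ ΣpairsQ n g
ΣpairsQ-cong n f≡g = Σℚ-cong n (λ x → Σℚ-cong n (λ y → cong (λ q → if ⌊ x <? y ⌋ then q else 0ℚ) (f≡g x y)))

ΣpairsQ-≡0 : ∀ n {f : Fin n → Fin n → ℚ} → (∀ i j → f i j ≡ 0ℚ) → ΣpairsQ n f ≡ 0ℚ
ΣpairsQ-≡0 n f≡0 = Σℚ-≡0 n (λ x → Σℚ-≡0 n (λ y → if-≡0 ⌊ x <? y ⌋ (f≡0 x y)))
  where
  if-≡0 : ∀ b {q} → q ≡ 0ℚ → (if b then q else 0ℚ) ≡ 0ℚ
  if-≡0 true  q≡0 = q≡0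
  if-≡0 false q≡0 = refl

ΣpairsQ-ℕ→ℚ-*ʳ : ∀ n (h : Fin n → Fin n → ℕ) r → ΣpairsQ n (λ x y → ℕ→ℚ (h x y) * r) ≡ ℕ→ℚ (ΣpairsN n h) * r
ΣpairsQ-ℕ→ℚ-*ʳ n h r =
  trans (Σℚ-cong n (λ x → trans (Σℚ-cong n (λ y → if-ℕ→ℚ ⌊ x <? y ⌋)) (Σℚ-ℕ→ℚ-*ʳ n _ r))) (Σℚ-ℕ→ℚ-*ʳ n _ r)
  where
  if-ℕ→ℚ : ∀ {x y} b → (if b then ℕ→ℚ (h x y) * r else 0ℚ) ≡ ℕ→ℚ (if b then h x y else 0) * r
  if-ℕ→ℚ true  = refl
  if-ℕ→ℚ false = ≡-sym (*-zeroˡ r)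

ΣpairsQ-suc : ∀ n f →
  ΣpairsQ (suc n) f ≡ Σℚ n (λ y → f zero (suc y)) + ΣpairsQ n (λ x y → f (suc x) (suc y))
ΣpairsQ-suc n f = cong₂ _+_ (+-identityˡ (Σℚ n (λ y → f zero (suc y))))
  (Σℚ-cong n (λ x → trans (+-identityˡ _)
    (Σℚ-cong n (λ y → cong (λ b → if b then f (suc x) (suc y) else 0ℚ) (⌊suc<?suc⌋ x y)))))

ΣpairsQ-V₁ : ∀ n f → ΣpairsQ (2 ℕ.+ n) f ≡
  (f sV tV + Σℚ n (λ i → f sV (vV i))) + (Σℚ n (λ i → f tV (vV i)) + ΣpairsQ n (λ i j → f (vV i) (vV j)))
ΣpairsQ-V₁ n f = trans (ΣpairsQ-suc (suc n) f) (cong (λ q → (f sV tV + Σℚ n (λ i → f sV (vV i))) + q) (ΣpairsQ-suc n (λ x y → f (suc x) (suc y))))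

sparsity-≥ : ∀ {N} (G : SCInstance N) A r → 0ℚ ≤ demand G A → r * demand G A ≤ capacity G A →
  fin r ≤∞ sparsity G A
sparsity-≥ G A r d≥0 rd≤c with demand G A ≟ 0ℚ
... | yes _   = tt
... | no d≢0 = *-cancelʳ-≤-pos d {{d>0}} (begin
    r * d                  ≤⟨ rd≤c ⟩
    c                      ≡⟨ *-identityʳ c ⟨
    c * 1ℚ                 ≡⟨ cong (c *_) (*-inverseˡ d {{d≢0′}}) ⟨
    c * ((1/ d) {{d≢0′}} * d) ≡⟨ *-assoc c _ d ⟨
    (c * (1/ d) {{d≢0′}}) * d ∎)
  where
  open ≤-Reasoning
  c = capacity G A
  d = demand G A
  d≢0′ = ≢-nonZero d≢0
  d>0 = nonNeg∧nonZero⇒pos d {{nonNegative d≥0}} {{d≢0′}}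

q≤p⇒1/p*q≤1 : ∀ p .{{_ : NonZero p}} q → 0ℚ ≤ q → q ≤ p → 1/ p * q ≤ 1ℚ
q≤p⇒1/p*q≤1 p q q≥0 q≤p = begin
    1/ p * q ≤⟨ *-monoˡ-≤-nonNeg (1/ p) {{1/p≥0}} q≤p ⟩
    1/ p * p ≡⟨ *-inverseˡ p ⟩
    1ℚ       ∎
  where
  open ≤-Reasoning
  p>0 = nonNeg∧nonZero⇒pos p {{nonNegative (≤-trans q≥0 q≤p)}}
  1/p≥0 : NonNegative (1/ p)
  1/p≥0 = pos⇒nonNeg ((1/ p) {{pos⇒nonZero p {{p>0}}}}) {{1/pos⇒pos p {{p>0}}}}

module G₁-Cuts {n : ℕ} (H : Graph n) .{{m≢0 : ℕ.NonZero (numEdges H)}} where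

  m : ℕ
  m = numEdges H

  1/m : ℚ
  1/m = + 1 / m

  instance
    1/m≥0 : NonNegative 1/m
    1/m≥0 = normalize-nonNeg 1 m

  *m*1/m : ∀ q → q * ℕ→ℚ m * 1/m ≡ q
  *m*1/m q = trans (*-assoc q (ℕ→ℚ m) 1/m) (trans (cong (q *_) (ℕ→ℚ*1/≡1 m)) (*-identityʳ q))

  capST≡ : ∀ i b → capST H i * indℚ b ≡ ℕ→ℚ (deg H i ℕ.* ind b) * (1/m * ½)
  capST≡ i b = begin
      ((+ deg H i / m) * ½) * indℚ b
    ≡⟨ cong₂ (λ x y → (x * ½) * y) (+/≡ℕ→ℚ*1/ (deg H i) m) (indℚ≡ℕ→ℚ∘ind b) ⟩
      ((ℕ→ℚ (deg H i) * 1/m) * ½) * ℕ→ℚ (ind b)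
    ≡⟨ solve 4 (λ D U h B → ((D :* U) :* h) :* B := (D :* B) :* (U :* h)) refl (ℕ→ℚ (deg H i)) 1/m ½ (ℕ→ℚ (ind b)) ⟩
      (ℕ→ℚ (deg H i) * ℕ→ℚ (ind b)) * (1/m * ½)
    ≡⟨ cong (_* (1/m * ½)) (ℕ→ℚ-* (deg H i) (ind b)) ⟨
      ℕ→ℚ (deg H i ℕ.* ind b) * (1/m * ½) ∎
    where
    open ≡-Reasoning
    open ℚ-Solver.+-*-Solver

  capacity-G₁ : ∀ A →
    capacity (G₁ H) A ≡ ℕ→ℚ (degOutside H (A ∘ vV) (A sV) ℕ.+ degOutside H (A ∘ vV) (A tV)) * (1/m * ½)
  capacity-G₁ A = begin
      capacity (G₁ H) A
    ≡⟨ ΣpairsQ-V₁ n F ⟩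
      (0ℚ * indℚ (A sV xor A tV) + fromS) + (fromT + ΣpairsQ n (λ i j → 0ℚ * indℚ (A (vV i) xor A (vV j))))
    ≡⟨ cong₂ (λ x y → (x + fromS) + (fromT + y))
             (*-zeroˡ (indℚ (A sV xor A tV))) (ΣpairsQ-≡0 n (λ i j → *-zeroˡ (indℚ (A (vV i) xor A (vV j))))) ⟩
      (0ℚ + fromS) + (fromT + 0ℚ)
    ≡⟨ cong₂ _+_ (+-identityˡ fromS) (+-identityʳ fromT) ⟩
      fromS + fromT
    ≡⟨ cong₂ _+_ (fromSide≡ (A sV)) (fromSide≡ (A tV)) ⟩
      ℕ→ℚ Ds * (1/m * ½) + ℕ→ℚ Dt * (1/m * ½)
    ≡⟨ *-distribʳ-+ (1/m * ½) (ℕ→ℚ Ds) (ℕ→ℚ Dt) ⟨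
      (ℕ→ℚ Ds + ℕ→ℚ Dt) * (1/m * ½)
    ≡⟨ cong (_* (1/m * ½)) (ℕ→ℚ-+ Ds Dt) ⟨
      ℕ→ℚ (Ds ℕ.+ Dt) * (1/m * ½) ∎
    where
    Ds = degOutside H (A ∘ vV) (A sV)
    Dt = degOutside H (A ∘ vV) (A tV)
    open ≡-Reasoning
    F : Fin (2 ℕ.+ n) → Fin (2 ℕ.+ n) → ℚ
    F x y = G₁cap H x y * indℚ (A x xor A y)
    fromSide : Bool → ℚ
    fromSide a = Σℚ n (λ i → capST H i * indℚ (a xor A (vV i)))
    fromS = fromSide (A sV)
    fromT = fromSide (A tV)
    fromSide≡ : ∀ a → fromSide a ≡ ℕ→ℚ (degOutside H (A ∘ vV) a) * (1/m * ½)
    fromSide≡ a = trans (Σℚ-cong n (λ i → capST≡ i (a xor A (vV i))))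
                        (Σℚ-ℕ→ℚ-*ʳ n (λ i → deg H i ℕ.* ind (a xor A (vV i))) (1/m * ½))

  demand-G₁ : ∀ A → demand (G₁ H) A ≡ ℕ→ℚ (cutSizeH H (A ∘ vV)) * 1/m
  demand-G₁ A = begin
      demand (G₁ H) A
    ≡⟨ ΣpairsQ-V₁ n F ⟩
      (0ℚ * indℚ (A sV xor A tV) + Σℚ n (λ i → 0ℚ * indℚ (A sV xor A (vV i))))
        + (Σℚ n (λ i → 0ℚ * indℚ (A tV xor A (vV i))) + ΣpairsQ n (λ i j → F (vV i) (vV j)))
    ≡⟨ cong₂ _+_ (cong₂ _+_ (*-zeroˡ (indℚ (A sV xor A tV))) (Σℚ-≡0 n (λ i → *-zeroˡ (indℚ (A sV xor A (vV i))))))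
                 (cong₂ _+_ (Σℚ-≡0 n (λ i → *-zeroˡ (indℚ (A tV xor A (vV i))))) (ΣpairsQ-cong n edge≡)) ⟩
      0ℚ + (0ℚ + ΣpairsQ n (λ i j → ℕ→ℚ (ind (adj H i j) ℕ.* ind (A (vV i) xor A (vV j))) * 1/m))
    ≡⟨ trans (+-identityˡ (0ℚ + cut)) (+-identityˡ cut) ⟩
      ΣpairsQ n (λ i j → ℕ→ℚ (ind (adj H i j) ℕ.* ind (A (vV i) xor A (vV j))) * 1/m)
    ≡⟨ ΣpairsQ-ℕ→ℚ-*ʳ n (λ i j → ind (adj H i j) ℕ.* ind (A (vV i) xor A (vV j))) 1/m ⟩
      ℕ→ℚ (cutSizeH H (A ∘ vV)) * 1/m ∎
    where
    cut = ΣpairsQ n (λ i j → ℕ→ℚ (ind (adj H i j) ℕ.* ind (A (vV i) xor A (vV j))) * 1/m)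
    open ≡-Reasoning
    F : Fin (2 ℕ.+ n) → Fin (2 ℕ.+ n) → ℚ
    F x y = G₁dem H x y * indℚ (A x xor A y)
    demand-edge : ∀ e b → (if e then 1/m else 0ℚ) * indℚ b ≡ ℕ→ℚ (ind e ℕ.* ind b) * 1/m
    demand-edge true  true  = trans (*-identityʳ 1/m) (≡-sym (*-identityˡ 1/m))
    demand-edge true  false = trans (*-zeroʳ 1/m) (≡-sym (*-zeroˡ 1/m))
    demand-edge false b     = trans (*-zeroˡ (indℚ b)) (≡-sym (*-zeroˡ 1/m))
    edge≡ : ∀ i j → F (vV i) (vV j) ≡ ℕ→ℚ (ind (adj H i j) ℕ.* ind (A (vV i) xor A (vV j))) * 1/m
    edge≡ i j = demand-edge (adj H i j) (A (vV i) xor A (vV j))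

  capacity-G₁-separating : ∀ A → Separates A sV tV → capacity (G₁ H) A ≡ 1ℚ
  capacity-G₁-separating A s|t = begin
      capacity (G₁ H) A
    ≡⟨ capacity-G₁ A ⟩
      ℕ→ℚ (degOutside H (A ∘ vV) (A sV) ℕ.+ degOutside H (A ∘ vV) (A tV)) * (1/m * ½)
    ≡⟨ cong (λ k → ℕ→ℚ k * (1/m * ½)) (degOutside-complementary H (A ∘ vV) (A sV) (A tV) s|t) ⟩
      ℕ→ℚ (2 ℕ.* m) * (1/m * ½)
    ≡⟨ cong (_* (1/m * ½)) (ℕ→ℚ-* 2 m) ⟩
      (ℕ→ℚ 2 * ℕ→ℚ m) * (1/m * ½)
    ≡⟨ solve 4 (λ T M U h → (T :* M) :* (U :* h) := (M :* U) :* (T :* h)) refl (ℕ→ℚ 2) (ℕ→ℚ m) 1/m ½ ⟩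
      (ℕ→ℚ m * 1/m) * (ℕ→ℚ 2 * ½)
    ≡⟨ cong (_* (ℕ→ℚ 2 * ½)) (ℕ→ℚ*1/≡1 m) ⟩
      1ℚ ∎
    where
    open ≡-Reasoning
    open ℚ-Solver.+-*-Solver

  capacity-G₁-nonseparating : ∀ A → ¬ Separates A sV tV →
    capacity (G₁ H) A ≡ ℕ→ℚ (degOutside H (A ∘ vV) (A sV)) * 1/m
  capacity-G₁-nonseparating A ¬s|t = begin
      capacity (G₁ H) A
    ≡⟨ capacity-G₁ A ⟩
      ℕ→ℚ (Ds ℕ.+ degOutside H (A ∘ vV) (A tV)) * (1/m * ½)
    ≡⟨ cong (λ b → ℕ→ℚ (Ds ℕ.+ degOutside H (A ∘ vV) b) * (1/m * ½)) (≡-sym (xor≢true⇒≡ (A sV) (A tV) ¬s|t)) ⟩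
      ℕ→ℚ (Ds ℕ.+ Ds) * (1/m * ½)
    ≡⟨ cong (_* (1/m * ½)) (ℕ→ℚ-+ Ds Ds) ⟩
      (ℕ→ℚ Ds + ℕ→ℚ Ds) * (1/m * ½)
    ≡⟨ solve 2 (λ D U → (D :+ D) :* (U :* con ½) := D :* U) refl (ℕ→ℚ Ds) 1/m ⟩
      ℕ→ℚ Ds * 1/m ∎
    where
    open ≡-Reasoning
    open ℚ-Solver.+-*-Solver
    Ds = degOutside H (A ∘ vV) (A sV)

  demand-G₁-nonNeg : ∀ A → 0ℚ ≤ demand (G₁ H) A
  demand-G₁-nonNeg A = begin
    0ℚ                              ≡⟨ *-zeroˡ 1/m ⟨
    ℕ→ℚ 0 * 1/m                     ≤⟨ *-monoʳ-≤-nonNeg 1/m (ℕ→ℚ-mono-≤ {0} {cutSizeH H (A ∘ vV)} ℕ.z≤n) ⟩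
    ℕ→ℚ (cutSizeH H (A ∘ vV)) * 1/m ≡⟨ demand-G₁ A ⟨
    demand (G₁ H) A                 ∎
    where open ≤-Reasoning

  separating-cut : ∀ c S → ℕ→ℚ (cutSizeH H S) ≡ c * ℕ→ℚ m →
    Σ (Fin (2 ℕ.+ n) → Bool) λ A → Separates A sV tV × capacity (G₁ H) A ≡ 1ℚ × demand (G₁ H) A ≡ c
  separating-cut c S cut≡cm = A , refl , capacity-G₁-separating A refl ,
    trans (demand-G₁ A) (trans (cong (_* 1/m) cut≡cm) (*m*1/m c))
    where
    A : Fin (2 ℕ.+ n) → Bool
    A zero          = true
    A (suc zero)    = false
    A (suc (suc i)) = S i

  sparsity-separating : ∀ s .{{_ : NonZero s}} → (∀ S → ℕ→ℚ (cutSizeH H S) ≤ s * ℕ→ℚ m) →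
    ∀ A → Separates A sV tV → fin (1/ s) ≤∞ sparsity (G₁ H) A
  sparsity-separating s maxCut≤sm A s|t = sparsity-≥ (G₁ H) A (1/ s) (demand-G₁-nonNeg A) (begin
    1/ s * demand (G₁ H) A ≤⟨ q≤p⇒1/p*q≤1 s (demand (G₁ H) A) (demand-G₁-nonNeg A) demand≤s ⟩
    1ℚ                     ≡⟨ capacity-G₁-separating A s|t ⟨
    capacity (G₁ H) A      ∎)
    where
    open ≤-Reasoning
    demand≤s : demand (G₁ H) A ≤ s
    demand≤s = begin
      demand (G₁ H) A                 ≡⟨ demand-G₁ A ⟩
      ℕ→ℚ (cutSizeH H (A ∘ vV)) * 1/m ≤⟨ *-monoʳ-≤-nonNeg 1/m (maxCut≤sm (A ∘ vV)) ⟩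
      s * ℕ→ℚ m * 1/m                 ≡⟨ *m*1/m s ⟩
      s                               ∎

  sparsity-nonseparating : ∀ A → ¬ Separates A sV tV → fin 1ℚ ≤∞ sparsity (G₁ H) A
  sparsity-nonseparating A ¬s|t = sparsity-≥ (G₁ H) A 1ℚ (demand-G₁-nonNeg A) (begin
    1ℚ * demand (G₁ H) A                     ≡⟨ *-identityˡ (demand (G₁ H) A) ⟩
    demand (G₁ H) A                          ≡⟨ demand-G₁ A ⟩
    ℕ→ℚ (cutSizeH H (A ∘ vV)) * 1/m          ≤⟨ *-monoʳ-≤-nonNeg 1/m
                                                  (ℕ→ℚ-mono-≤ (cutSizeH≤degOutside H (A ∘ vV) (A sV))) ⟩
    ℕ→ℚ (degOutside H (A ∘ vV) (A sV)) * 1/m ≡⟨ capacity-G₁-nonseparating A ¬s|t ⟨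
    capacity (G₁ H) A                        ∎)
    where open ≤-Reasoning

lemma4p3 : (n : ℕ) (H : Graph n) → Connected H → .{{m≢0 : ℕ.NonZero (numEdges H)}} →
    ((c : ℚ) (S : Fin n → Bool) → (+ cutSizeH H S / 1) ≡ c * (+ numEdges H / 1) →
      Σ (Fin (2 ℕ.+ n) → Bool) λ A →
        Separates A sV tV × capacity (G₁ H) A ≡ 1ℚ × demand (G₁ H) A ≡ c)
    × ((A : Fin (2 ℕ.+ n) → Bool) → Separates A sV tV → 1ℚ ≤ capacity (G₁ H) A)
    × ((s : ℚ) .{{s≢0 : NonZero s}} →
        ((S : Fin n → Bool) → (+ cutSizeH H S / 1) ≤ s * (+ numEdges H / 1)) →
        (Σ (Fin n → Bool) λ S → (+ cutSizeH H S / 1) ≡ s * (+ numEdges H / 1)) →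
        (A : Fin (2 ℕ.+ n) → Bool) → Separates A sV tV →
        fin (1/ s) ≤∞ sparsity (G₁ H) A)
    × ((A : Fin (2 ℕ.+ n) → Bool) → ¬ Separates A sV tV →
        fin 1ℚ ≤∞ sparsity (G₁ H) A)
lemma4p3 n H _ =
    separating-cut
  , (λ A s|t → ≤-reflexive (≡-sym (capacity-G₁-separating A s|t)))
  , (λ s maxCut≤sm _ → sparsity-separating s maxCut≤sm)
  , sparsity-nonseparating
  where open G₁-Cuts H
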